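{- For any $m\in\mathbb{Z}$ and $n\in\mathbb{Z}^+$, we have $$\sum_{r=0}^{n-1}\binom{2n}{r}u_{n-r}(m-2,1)=\sum_{k=0}^{n-1}\binom{2k}{k}m^{n-1-k},$$ $$\sum_{r=0}^{n-1}\binom{2n}{r}v_{n-r}(m-2,1)=m^n-\binom{2n}{n},$$ $$\sum_{r=0}^{n-1}\binom{2n-1}{r}u_{n-r}(m-2,1)=\frac12\sum_{k=0}^{n-1}\binom{2k}{k}m^{n-1-k}+\frac{m^{n-1}}{2},$$ $$\sum_{r=0}^{n-1}\binom{2n-1}{r}v_{n-r}(m-2,1)=\frac{m-4}{2}\sum_{k=0}^{n-1}\binom{2k}{k}m^{n-1-k}+\frac{m^n}{2}.$$
   Context: For integers $A,B$, $u_0(A,B)=0$, $u_1(A,B)=1$, $u_{n+1}(A,B)=Au_n(A,B)-Bu_{n-1}(A,B)$, and $v_0(A,B)=2$, $v_1(A,B)=A$, $v_{n+1}(A,B)=Av_n(A,B)-Bv_{n-1}(A,B)$ for $n\ge1$. -}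

module Defs where

open import Data.Nat as ℕ using (ℕ; zero; suc)
open import Data.Integer using (ℤ; +_; _+_; _-_; _*_)
open import Data.Nat.Combinatorics using (_C_)

u : ℤ → ℤ → ℕ → ℤ
u A B zero = + 0
u A B (suc zero) = + 1
u A B (suc (suc n)) = A * u A B (suc n) - B * u A B n

v : ℤ → ℤ → ℕ → ℤ
v A B zero = + 2
v A B (suc zero) = A
v A B (suc (suc n)) = A * v A B (suc n) - B * v A B n

sumTo : ℕ → (ℕ → ℤ) → ℤ
sumTo zero f = + 0
sumTo (suc n) f = sumTo n f + f n

binom : ℕ → ℕ → ℤ
binom n k = + (n C k)

-- Put S_N(c) = Σ_{r<c} C(N,r) w(c−r) for a sequence w with w(j+2) + w(j) = (m−2) w(j+1),
-- as u(m−2,1) and v(m−2,1) are. Applying Pascal's rule twice and pushing the recurrence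
-- of w through the sum gives
--   S_{N+2}(c+2) = m S_N(c+1) + C(N,c+1) w(1) − C(N,c) w(0),
-- so both sides of each identity satisfy the same first-order recurrence in n; the
-- inhomogeneous terms match by C(2k+2,k+1) = 2 C(2k+1,k+1) and C(2k+1,k) = C(2k+1,k+1).
{-# OPTIONS --safe #-}
module Submission where

open import Defs
open import Data.Nat as ℕ using (ℕ; zero; suc; _∸_)
open import Data.Integer using (ℤ; +_; _+_; _-_; _*_; _^_)
open import Data.Product using (_×_; _,_)
open import Relation.Binary.PropositionalEquality
  using (_≡_; refl; sym; trans; cong; cong₂; subst; module ≡-Reasoning)
open import Data.Integer.Tactic.RingSolver using (solve-∀)
import Data.Nat.Tactic.RingSolver as ℕ-Solver
import Data.Nat.Properties as ℕP
import Data.Integer.Properties as ℤP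
open import Data.Nat.Combinatorics using (_C_; nCk≡nC[n∸k]; nCk+nC[k+1]≡[n+1]C[k+1])
open import Algebra.Properties.CommutativeSemigroup ℤP.+-commutativeSemigroup using (interchange)
open import Algebra.Properties.CommutativeSemigroup ℤP.*-commutativeSemigroup using (x∙yz≈y∙xz)

open ≡-Reasoning

sumTo-cong< : ∀ n {f g : ℕ → ℤ} → (∀ r → r ℕ.< n → f r ≡ g r) → sumTo n f ≡ sumTo n g
sumTo-cong< zero    f≗g = refl
sumTo-cong< (suc n) f≗g =
  cong₂ _+_ (sumTo-cong< n (λ r r<n → f≗g r (ℕP.m<n⇒m<1+n r<n))) (f≗g n ℕP.≤-refl)

sumTo-distrib-+ : ∀ n (f g : ℕ → ℤ) → sumTo n (λ r → f r + g r) ≡ sumTo n f + sumTo n g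
sumTo-distrib-+ zero    f g = refl
sumTo-distrib-+ (suc n) f g =
  trans (cong (_+ (f n + g n)) (sumTo-distrib-+ n f g))
        (interchange (sumTo n f) (sumTo n g) (f n) (g n))

sumTo-*ˡ : ∀ n c (f : ℕ → ℤ) → sumTo n (λ r → c * f r) ≡ c * sumTo n f
sumTo-*ˡ zero    c f = sym (ℤP.*-zeroʳ c)
sumTo-*ˡ (suc n) c f =
  trans (cong (_+ (c * f n)) (sumTo-*ˡ n c f)) (sym (ℤP.*-distribˡ-+ c (sumTo n f) (f n)))

binom-suc-suc : ∀ N j → binom (suc N) (suc j) ≡ binom N j + binom N (suc j)
binom-suc-suc N j =
  trans (cong +_ (sym (nCk+nC[k+1]≡[n+1]C[k+1] N j))) (ℤP.pos-+ (N C j) (N C suc j))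

sumTo-binom-suc : ∀ N k (h : ℕ → ℤ) →
  sumTo (suc k) (λ r → binom (suc N) r * h r)
    ≡ sumTo (suc k) (λ r → binom N r * h r) + sumTo k (λ r → binom N r * h (suc r))
sumTo-binom-suc N zero    h = sym (ℤP.+-identityʳ _)
sumTo-binom-suc N (suc j) h =
  trans (cong₂ _+_ (sumTo-binom-suc N j h) (cong (_* h (suc j)) (binom-suc-suc N j)))
        (regroup (sumTo (suc j) (λ r → binom N r * h r)) (sumTo j (λ r → binom N r * h (suc r)))
                 (binom N j) (binom N (suc j)) (h (suc j)))
  where
  regroup : ∀ A B x y z → (A + B) + (x + y) * z ≡ (A + y * z) + (B + x * z)
  regroup = solve-∀

binomialSum : ℕ → ℕ → (ℕ → ℤ) → ℤ
binomialSum N c w = sumTo c (λ r → binom N r * w (c ∸ r))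

binomialSum-pascal : ∀ N c w →
  binomialSum (suc N) (suc c) w ≡ binomialSum N (suc c) w + binomialSum N c w
binomialSum-pascal N c w = sumTo-binom-suc N c (λ r → w (suc c ∸ r))

private
  a-1*b+b≡a : ∀ a b → (a - + 1 * b) + b ≡ a
  a-1*b+b≡a = solve-∀

u-rec : ∀ A j → u A (+ 1) (suc (suc j)) + u A (+ 1) j ≡ A * u A (+ 1) (suc j)
u-rec A j = a-1*b+b≡a (A * u A (+ 1) (suc j)) (u A (+ 1) j)

v-rec : ∀ A j → v A (+ 1) (suc (suc j)) + v A (+ 1) j ≡ A * v A (+ 1) (suc j)
v-rec A j = a-1*b+b≡a (A * v A (+ 1) (suc j)) (v A (+ 1) j)

binom-sym : ∀ a b → (a ℕ.+ b) C a ≡ (a ℕ.+ b) C b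
binom-sym a b = trans (nCk≡nC[n∸k] (ℕP.m≤m+n a b)) (cong ((a ℕ.+ b) C_) (ℕP.m+n∸m≡n a b))

odd-central-sym : ∀ j → suc (2 ℕ.* j) C j ≡ suc (2 ℕ.* j) C suc j
odd-central-sym j = subst (λ N → N C j ≡ N C suc j) (sym (odd≡ j)) (binom-sym j (suc j))
  where
  odd≡ : ∀ j → suc (2 ℕ.* j) ≡ j ℕ.+ suc j
  odd≡ = ℕ-Solver.solve-∀

binom-even-central : ∀ j → binom (2 ℕ.* suc j) (suc j) ≡ + 2 * binom (suc (2 ℕ.* j)) (suc j)
binom-even-central j = begin
    binom (2 ℕ.* suc j) (suc j)
  ≡⟨ cong (λ N → binom N (suc j)) (ℕP.*-suc 2 j) ⟩
    binom (suc (suc (2 ℕ.* j))) (suc j)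
  ≡⟨ binom-suc-suc (suc (2 ℕ.* j)) j ⟩
    binom (suc (2 ℕ.* j)) j + binom (suc (2 ℕ.* j)) (suc j)
  ≡⟨ cong (λ x → + x + binom (suc (2 ℕ.* j)) (suc j)) (odd-central-sym j) ⟩
    binom (suc (2 ℕ.* j)) (suc j) + binom (suc (2 ℕ.* j)) (suc j)
  ≡⟨ double (binom (suc (2 ℕ.* j)) (suc j)) ⟩
    + 2 * binom (suc (2 ℕ.* j)) (suc j)
  ∎
  where
  double : ∀ x → x + x ≡ + 2 * x
  double = solve-∀

binom-even-central-suc : ∀ j → binom (2 ℕ.* suc (suc j)) (suc (suc j))
  ≡ + 2 * binom (2 ℕ.* suc j) (suc j) + + 2 * binom (2 ℕ.* suc j) j
binom-even-central-suc j = begin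
    binom (2 ℕ.* suc (suc j)) (suc (suc j))
  ≡⟨ binom-even-central (suc j) ⟩
    + 2 * binom (suc M) (suc (suc j))
  ≡⟨ cong (+ 2 *_) (binom-suc-suc M (suc j)) ⟩
    + 2 * (binom M (suc j) + binom M (suc (suc j)))
  ≡⟨ cong (λ x → + 2 * (binom M (suc j) + + x)) (subst (λ N → N C suc (suc j) ≡ N C j)
       (sym (even≡ j)) (binom-sym (suc (suc j)) j)) ⟩
    + 2 * (binom M (suc j) + binom M j)
  ≡⟨ ℤP.*-distribˡ-+ (+ 2) (binom M (suc j)) (binom M j) ⟩
    + 2 * binom M (suc j) + + 2 * binom M j
  ∎
  where
  M = 2 ℕ.* suc j
  even≡ : ∀ j → 2 ℕ.* suc j ≡ suc (suc j) ℕ.+ j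
  even≡ = ℕ-Solver.solve-∀

centralBinomialSum : ℤ → ℕ → ℤ
centralBinomialSum m n = sumTo n (λ k → binom (2 ℕ.* k) k * m ^ (n ∸ 1 ∸ k))

centralBinomialSum-suc : ∀ m n →
  centralBinomialSum m (suc n) ≡ m * centralBinomialSum m n + binom (2 ℕ.* n) n
centralBinomialSum-suc m zero    = cong (_+ + 1) (sym (ℤP.*-zeroʳ m))
centralBinomialSum-suc m (suc n) =
  cong₂ _+_ (trans (sumTo-cong< (suc n) termwise)
                   (sumTo-*ˡ (suc n) m (λ k → binom (2 ℕ.* k) k * m ^ (n ∸ k))))
            (trans (cong (λ i → binom (2 ℕ.* suc n) (suc n) * m ^ i) (ℕP.n∸n≡0 n))
                   (ℤP.*-identityʳ _))
  where
  termwise : ∀ k → k ℕ.< suc n →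
    binom (2 ℕ.* k) k * m ^ (suc n ∸ k) ≡ m * (binom (2 ℕ.* k) k * m ^ (n ∸ k))
  termwise k (ℕ.s≤s k≤n) rewrite ℕP.+-∸-assoc 1 k≤n = x∙yz≈y∙xz (binom (2 ℕ.* k) k) m (m ^ (n ∸ k))

module _ (m : ℤ) (w : ℕ → ℤ) (w-rec : ∀ j → w (suc (suc j)) + w j ≡ (m - + 2) * w (suc j)) where

  binomialSum-shift : ∀ N c →
    binomialSum N (suc (suc c)) w + binomialSum N c w
      ≡ (m - + 2) * binomialSum N (suc c) w + binom N (suc c) * w 1 - binom N c * w 0
  binomialSum-shift N c = begin
      (Y + a (suc c ∸ c)) + binomialSum N c w
    ≡⟨ regroup Y (binomialSum N c w) (a (suc c ∸ c)) (b (c ∸ c)) ⟩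
      (Y + (binomialSum N c w + b (c ∸ c))) + a (suc c ∸ c) - b (c ∸ c)
    ≡⟨ cong (λ t → t + a (suc c ∸ c) - b (c ∸ c)) (sym (sumTo-distrib-+ (suc c) _ _)) ⟩
      sumTo (suc c) (λ r → binom N r * w (suc (suc c) ∸ r) + binom N r * w (c ∸ r))
        + a (suc c ∸ c) - b (c ∸ c)
    ≡⟨ cong (λ t → t + a (suc c ∸ c) - b (c ∸ c)) (trans (sumTo-cong< (suc c) termwise)
         (sumTo-*ˡ (suc c) (m - + 2) (λ r → binom N r * w (suc c ∸ r)))) ⟩
      (m - + 2) * binomialSum N (suc c) w + a (suc c ∸ c) - b (c ∸ c)
    ≡⟨ cong₂ (λ i j → (m - + 2) * binomialSum N (suc c) w + a i - b j)
         (ℕP.m+n∸n≡m 1 c) (ℕP.n∸n≡0 c) ⟩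
      (m - + 2) * binomialSum N (suc c) w + a 1 - b 0
    ∎
    where
    Y = sumTo (suc c) (λ r → binom N r * w (suc (suc c) ∸ r))
    a b : ℕ → ℤ
    a i = binom N (suc c) * w i
    b i = binom N c * w i
    regroup : ∀ Y S x y → (Y + x) + S ≡ (Y + (S + y)) + x - y
    regroup = solve-∀
    termwise : ∀ r → r ℕ.< suc c →
      binom N r * w (suc (suc c) ∸ r) + binom N r * w (c ∸ r)
        ≡ (m - + 2) * (binom N r * w (suc c ∸ r))
    termwise r (ℕ.s≤s r≤c)
      rewrite ℕP.+-∸-assoc 2 r≤c | ℕP.+-∸-assoc 1 r≤c = begin
        binom N r * w (suc (suc (c ∸ r))) + binom N r * w (c ∸ r)
      ≡⟨ sym (ℤP.*-distribˡ-+ (binom N r) _ _) ⟩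
        binom N r * (w (suc (suc (c ∸ r))) + w (c ∸ r))
      ≡⟨ cong (binom N r *_) (w-rec (c ∸ r)) ⟩
        binom N r * ((m - + 2) * w (suc (c ∸ r)))
      ≡⟨ x∙yz≈y∙xz (binom N r) (m - + 2) (w (suc (c ∸ r))) ⟩
        (m - + 2) * (binom N r * w (suc (c ∸ r)))
      ∎

  binomialSum-step : ∀ N c →
    binomialSum (suc (suc N)) (suc (suc c)) w
      ≡ m * binomialSum N (suc c) w + binom N (suc c) * w 1 - binom N c * w 0
  binomialSum-step N c = begin
      binomialSum (suc (suc N)) (suc (suc c)) w
    ≡⟨ binomialSum-pascal (suc N) (suc c) w ⟩
      binomialSum (suc N) (suc (suc c)) w + binomialSum (suc N) (suc c) w
    ≡⟨ cong₂ _+_ (binomialSum-pascal N (suc c) w) (binomialSum-pascal N c w) ⟩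
      (binomialSum N (suc (suc c)) w + S) + (S + binomialSum N c w)
    ≡⟨ regroup (binomialSum N (suc (suc c)) w) S (binomialSum N c w) ⟩
      (binomialSum N (suc (suc c)) w + binomialSum N c w) + + 2 * S
    ≡⟨ cong (_+ + 2 * S) (binomialSum-shift N c) ⟩
      ((m - + 2) * S + binom N (suc c) * w 1 - binom N c * w 0) + + 2 * S
    ≡⟨ collect m S (binom N (suc c) * w 1) (binom N c * w 0) ⟩
      m * S + binom N (suc c) * w 1 - binom N c * w 0
    ∎
    where
    S = binomialSum N (suc c) w
    regroup : ∀ A S B → (A + S) + (S + B) ≡ (A + B) + + 2 * S
    regroup = solve-∀
    collect : ∀ m S x y → ((m - + 2) * S + x - y) + + 2 * S ≡ m * S + x - y
    collect = solve-∀

  binomialSum-even-step : ∀ j →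
    binomialSum (2 ℕ.* suc (suc j)) (suc (suc j)) w
      ≡ m * binomialSum (2 ℕ.* suc j) (suc j) w
          + binom (2 ℕ.* suc j) (suc j) * w 1 - binom (2 ℕ.* suc j) j * w 0
  binomialSum-even-step j =
    trans (cong (λ N → binomialSum N (suc (suc j)) w) (ℕP.*-suc 2 (suc j)))
          (binomialSum-step (2 ℕ.* suc j) j)

  binomialSum-odd-step : ∀ j →
    binomialSum (suc (2 ℕ.* suc j)) (suc (suc j)) w
      ≡ m * binomialSum (suc (2 ℕ.* j)) (suc j) w + binom (suc (2 ℕ.* j)) (suc j) * (w 1 - w 0)
  binomialSum-odd-step j = begin
      binomialSum (suc (2 ℕ.* suc j)) (suc (suc j)) w
    ≡⟨ cong (λ N → binomialSum (suc N) (suc (suc j)) w) (ℕP.*-suc 2 j) ⟩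
      binomialSum (suc (suc (suc (2 ℕ.* j)))) (suc (suc j)) w
    ≡⟨ binomialSum-step (suc (2 ℕ.* j)) j ⟩
      m * S + binom (suc (2 ℕ.* j)) (suc j) * w 1 - binom (suc (2 ℕ.* j)) j * w 0
    ≡⟨ cong (λ x → m * S + binom (suc (2 ℕ.* j)) (suc j) * w 1 - + x * w 0) (odd-central-sym j) ⟩
      m * S + binom (suc (2 ℕ.* j)) (suc j) * w 1 - binom (suc (2 ℕ.* j)) (suc j) * w 0
    ≡⟨ factor (m * S) (binom (suc (2 ℕ.* j)) (suc j)) (w 1) (w 0) ⟩
      m * S + binom (suc (2 ℕ.* j)) (suc j) * (w 1 - w 0)
    ∎
    where
    S = binomialSum (suc (2 ℕ.* j)) (suc j) w
    factor : ∀ a b x y → a + b * x - b * y ≡ a + b * (x - y)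
    factor = solve-∀

module _ (m : ℤ) where

  private
    U V : ℕ → ℤ
    U = u (m - + 2) (+ 1)
    V = v (m - + 2) (+ 1)
    T : ℕ → ℤ
    T = centralBinomialSum m

  binomialSum-even-u : ∀ k → binomialSum (2 ℕ.* suc k) (suc k) U ≡ T (suc k)
  binomialSum-even-u zero    = refl
  binomialSum-even-u (suc j) = begin
      binomialSum (2 ℕ.* suc (suc j)) (suc (suc j)) U
    ≡⟨ binomialSum-even-step m U (u-rec (m - + 2)) j ⟩
      m * binomialSum (2 ℕ.* suc j) (suc j) U + B * + 1 - B′ * + 0
    ≡⟨ cong (λ t → m * t + B * + 1 - B′ * + 0) (binomialSum-even-u j) ⟩
      m * T (suc j) + B * + 1 - B′ * + 0
    ≡⟨ simplify (m * T (suc j)) B B′ ⟩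
      m * T (suc j) + B
    ≡⟨ sym (centralBinomialSum-suc m (suc j)) ⟩
      T (suc (suc j))
    ∎
    where
    B = binom (2 ℕ.* suc j) (suc j)
    B′ = binom (2 ℕ.* suc j) j
    simplify : ∀ a b c → a + b * + 1 - c * + 0 ≡ a + b
    simplify = solve-∀

  binomialSum-even-v : ∀ k →
    binomialSum (2 ℕ.* suc k) (suc k) V ≡ m ^ suc k - binom (2 ℕ.* suc k) (suc k)
  binomialSum-even-v zero    = base m
    where
    base : ∀ m → + 0 + + 1 * (m - + 2) ≡ m * + 1 - + 2
    base = solve-∀
  binomialSum-even-v (suc j) = begin
      binomialSum (2 ℕ.* suc (suc j)) (suc (suc j)) V
    ≡⟨ binomialSum-even-step m V (v-rec (m - + 2)) j ⟩
      m * binomialSum (2 ℕ.* suc j) (suc j) V + B * (m - + 2) - B′ * + 2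
    ≡⟨ cong (λ t → m * t + B * (m - + 2) - B′ * + 2) (binomialSum-even-v j) ⟩
      m * (m ^ suc j - B) + B * (m - + 2) - B′ * + 2
    ≡⟨ rearrange m (m ^ suc j) B B′ ⟩
      m ^ suc (suc j) - (+ 2 * B + + 2 * B′)
    ≡⟨ cong (m ^ suc (suc j) -_) (sym (binom-even-central-suc j)) ⟩
      m ^ suc (suc j) - binom (2 ℕ.* suc (suc j)) (suc (suc j))
    ∎
    where
    B = binom (2 ℕ.* suc j) (suc j)
    B′ = binom (2 ℕ.* suc j) j
    rearrange : ∀ m p b c → m * (p - b) + b * (m - + 2) - c * + 2 ≡ m * p - (+ 2 * b + + 2 * c)
    rearrange = solve-∀

  binomialSum-odd-u : ∀ k → + 2 * binomialSum (suc (2 ℕ.* k)) (suc k) U ≡ T (suc k) + m ^ k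
  binomialSum-odd-u zero    = refl
  binomialSum-odd-u (suc j) = begin
      + 2 * binomialSum (suc (2 ℕ.* suc j)) (suc (suc j)) U
    ≡⟨ cong (+ 2 *_) (binomialSum-odd-step m U (u-rec (m - + 2)) j) ⟩
      + 2 * (m * S + B * (+ 1 - + 0))
    ≡⟨ rearrange m S B ⟩
      m * (+ 2 * S) + + 2 * B
    ≡⟨ cong₂ (λ a b → m * a + b) (binomialSum-odd-u j) (sym (binom-even-central j)) ⟩
      m * (T (suc j) + m ^ j) + binom (2 ℕ.* suc j) (suc j)
    ≡⟨ regroup m (T (suc j)) (m ^ j) (binom (2 ℕ.* suc j) (suc j)) ⟩
      (m * T (suc j) + binom (2 ℕ.* suc j) (suc j)) + m ^ suc j
    ≡⟨ cong (_+ m ^ suc j) (sym (centralBinomialSum-suc m (suc j))) ⟩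
      T (suc (suc j)) + m ^ suc j
    ∎
    where
    S = binomialSum (suc (2 ℕ.* j)) (suc j) U
    B = binom (suc (2 ℕ.* j)) (suc j)
    rearrange : ∀ m s b → + 2 * (m * s + b * (+ 1 - + 0)) ≡ m * (+ 2 * s) + + 2 * b
    rearrange = solve-∀
    regroup : ∀ m t p b → m * (t + p) + b ≡ (m * t + b) + m * p
    regroup = solve-∀

  binomialSum-odd-v : ∀ k →
    + 2 * binomialSum (suc (2 ℕ.* k)) (suc k) V ≡ (m - + 4) * T (suc k) + m ^ suc k
  binomialSum-odd-v zero    = base m
    where
    base : ∀ m → + 2 * (+ 0 + + 1 * (m - + 2)) ≡ (m - + 4) * (+ 0 + + 1 * + 1) + m * + 1
    base = solve-∀
  binomialSum-odd-v (suc j) = begin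
      + 2 * binomialSum (suc (2 ℕ.* suc j)) (suc (suc j)) V
    ≡⟨ cong (+ 2 *_) (binomialSum-odd-step m V (v-rec (m - + 2)) j) ⟩
      + 2 * (m * S + B * ((m - + 2) - + 2))
    ≡⟨ rearrange m S B ⟩
      m * (+ 2 * S) + (m - + 4) * (+ 2 * B)
    ≡⟨ cong₂ (λ a b → m * a + (m - + 4) * b) (binomialSum-odd-v j) (sym (binom-even-central j)) ⟩
      m * ((m - + 4) * T (suc j) + m ^ suc j) + (m - + 4) * binom (2 ℕ.* suc j) (suc j)
    ≡⟨ regroup m (T (suc j)) (m ^ suc j) (binom (2 ℕ.* suc j) (suc j)) ⟩
      (m - + 4) * (m * T (suc j) + binom (2 ℕ.* suc j) (suc j)) + m ^ suc (suc j)
    ≡⟨ cong (λ t → (m - + 4) * t + m ^ suc (suc j)) (sym (centralBinomialSum-suc m (suc j))) ⟩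
      (m - + 4) * T (suc (suc j)) + m ^ suc (suc j)
    ∎
    where
    S = binomialSum (suc (2 ℕ.* j)) (suc j) V
    B = binom (suc (2 ℕ.* j)) (suc j)
    rearrange : ∀ m s b → + 2 * (m * s + b * ((m - + 2) - + 2)) ≡ m * (+ 2 * s) + (m - + 4) * (+ 2 * b)
    rearrange = solve-∀
    regroup : ∀ m t p b →
      m * ((m - + 4) * t + p) + (m - + 4) * b ≡ (m - + 4) * (m * t + b) + m * p
    regroup = solve-∀

lemma3p2 : (m : ℤ) (n : ℕ) → 1 ℕ.≤ n →
    (sumTo n (λ r → binom (2 ℕ.* n) r * u (m - + 2) (+ 1) (n ∸ r))
      ≡ sumTo n (λ k → binom (2 ℕ.* k) k * m ^ (n ∸ 1 ∸ k)))
    × (sumTo n (λ r → binom (2 ℕ.* n) r * v (m - + 2) (+ 1) (n ∸ r))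
      ≡ m ^ n - binom (2 ℕ.* n) n)
    × (+ 2 * sumTo n (λ r → binom (2 ℕ.* n ∸ 1) r * u (m - + 2) (+ 1) (n ∸ r))
      ≡ sumTo n (λ k → binom (2 ℕ.* k) k * m ^ (n ∸ 1 ∸ k)) + m ^ (n ∸ 1))
    × (+ 2 * sumTo n (λ r → binom (2 ℕ.* n ∸ 1) r * v (m - + 2) (+ 1) (n ∸ r))
      ≡ (m - + 4) * sumTo n (λ k → binom (2 ℕ.* k) k * m ^ (n ∸ 1 ∸ k)) + m ^ n)
lemma3p2 m (suc k) _ =
    binomialSum-even-u m k
  , binomialSum-even-v m k
  , trans (odd-index (u (m - + 2) (+ 1))) (binomialSum-odd-u m k)
  , trans (odd-index (v (m - + 2) (+ 1))) (binomialSum-odd-v m k)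
  where
  odd-index : ∀ w → + 2 * binomialSum (2 ℕ.* suc k ∸ 1) (suc k) w
                  ≡ + 2 * binomialSum (suc (2 ℕ.* k)) (suc k) w
  odd-index w = cong (λ N → + 2 * binomialSum (N ∸ 1) (suc k) w) (ℕP.*-suc 2 k)
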